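{- For every positive integer $N$ and every integer $n\ge 1$, $$B_{N,n}=n!\sum_{k=1}^{n}(-N!)^k\binom{n+1}{k+1}\sum_{\substack{i_1,\dots,i_k\ge 0\\ i_1+\cdots+i_k=n}}\frac{1}{(N+i_1)!\cdots(N+i_k)!}.$$
   Context: The hypergeometric Bernoulli numbers $B_{N,n}$ are defined by $\frac{1}{{}_1F_1(1;N+1;x)}=\sum_{n=0}^\infty B_{N,n}\frac{x^n}{n!}$, where ${}_1F_1(a;b;z)=\sum_{n=0}^\infty\frac{(a)^{(n)}}{(b)^{(n)}}\frac{z^n}{n!}$ with $(a)^{(n)}=a(a+1)\cdots(a+n-1)$, $(a)^{(0)}=1$; equivalently ${}_1F_1(1;N+1;x)=\sum_{j\ge0}\frac{N!\,x^j}{(N+j)!}$. -}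

module Defs where

open import Data.Nat as ℕ using (ℕ; zero; suc; _∸_; _!)
open import Data.Nat.Properties using (_!≢0)
open import Data.Nat.Combinatorics using (_C_)
open import Data.Integer using (+_)
open import Data.Rational using (ℚ; 0ℚ; 1ℚ; _+_; _*_; -_; _/_)
open import Data.List using (List; []; _∷_; [_]; map; foldr; zipWith; concatMap; upTo; applyUpTo)

Σℚ : List ℚ → ℚ
Σℚ = foldr _+_ 0ℚ

Πℚ : List ℚ → ℚ
Πℚ = foldr _*_ 1ℚ

_^ℚ_ : ℚ → ℕ → ℚ
q ^ℚ zero  = 1ℚ
q ^ℚ suc k = q * (q ^ℚ k)

ℕ→ℚ : ℕ → ℚ
ℕ→ℚ m = + m / 1

inv! : ℕ → ℚ
inv! m = (+ 1 / (m !)) {{m !≢0}}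

-- j-th coefficient of 1F1(1;N+1;x) = Σ_j N! x^j / (N+j)!
a : ℕ → ℕ → ℚ
a N j = ℕ→ℚ (N !) * inv! (N ℕ.+ j)

-- Coefficients of the formal power series 1 / 1F1(1;N+1;x) (the series
-- inverse, computed by the standard recursion from F·(1/F) = 1, using a N 0 = 1):
--   c 0 = 1,  c n = - Σ_{j=1}^{n} a_j c_{n-j}.
-- invList N n = [c n, c (n-1), ..., c 0].
invList : ℕ → ℕ → List ℚ
invList N zero    = [ 1ℚ ]
invList N (suc n) =
  (- Σℚ (zipWith _*_ (applyUpTo (λ j → a N (suc j)) (suc n)) (invList N n)))
  ∷ invList N n

invCoeff : ℕ → ℕ → ℚ
invCoeff N n with invList N n
... | c ∷ _ = c
... | []    = 0ℚ

-- hypergeometric Bernoulli number B_{N,n} = n! · [x^n] (1 / 1F1(1;N+1;x))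
B : ℕ → ℕ → ℚ
B N n = ℕ→ℚ (n !) * invCoeff N n

weakComps : ℕ → ℕ → List (List ℕ)
weakComps zero zero    = [ [] ]
weakComps zero (suc _) = []
weakComps (suc k) n =
  concatMap (λ i → map (i ∷_) (weakComps k (n ∸ i))) (upTo (suc n))

innerSum : ℕ → ℕ → ℕ → ℚ
innerSum N k n = Σℚ (map (λ is → Πℚ (map (λ i → inv! (N ℕ.+ i)) is)) (weakComps k n))

rhs : ℕ → ℕ → ℚ
rhs N n = ℕ→ℚ (n !) *
  Σℚ (map (λ k → ((- ℕ→ℚ (N !)) ^ℚ k) * ℕ→ℚ (suc n C suc k) * innerSum N k n)
          (applyUpTo suc n))

-- Write 1F1(1;N+1;x) = 1 - g with g(0) = 0, so that 1/1F1 is the geometric series Σ_m g^m,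
-- whose x^n coefficient only involves m ≤ n. Here g = 1 + e with e(x) = -N! Σ_j x^j/(N+j)!,
-- so g^m = Σ_k C(m,k) e^k, and the hockey stick identity Σ_{m≤n} C(m,k) = C(n+1,k+1)
-- turns the double sum into Σ_k C(n+1,k+1) [x^n] e^k. Finally [x^n] e^k = (-N!)^k times
-- the sum over weak compositions of n, and the k = 0 term vanishes for n ≥ 1.
module Submission where

open import Defs
open import Data.Nat using (ℕ; _≤_)
open import Data.Rational using (ℚ)
open import Relation.Binary.PropositionalEquality using (_≡_)

open import Data.Nat as ℕ using (zero; suc; _∸_; _!; _<_; s≤s; z<s; NonZero)
import Data.Nat.Properties as ℕ
open import Data.Nat.Combinatorics using (_C_; nCk+nC[k+1]≡[n+1]C[k+1])
import Data.Nat.Coprimality as Coprime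
import Data.Integer as ℤ
open import Data.Integer.Properties using (+◃n≡+n)
open import Data.Rational using (0ℚ; 1ℚ; _+_; _*_; -_; _/_; mkℚ)
open import Data.Rational.Properties
open import Data.List using (List; []; _∷_; map; zipWith; concatMap; upTo; applyUpTo; applyDownFrom; _++_)
open import Data.List.Properties using (map-++)
open import Data.Bool using (true; false; T)
open import Data.Unit using (tt)
open import Data.Sum using (inj₁; inj₂)
open import Relation.Nullary using (contradiction)
open import Relation.Binary.PropositionalEquality using (refl; sym; trans; cong; cong₂; subst; module ≡-Reasoning)
open import Algebra.Solver.Ring.AlmostCommutativeRing using (fromCommutativeRing)
open import Algebra.Solver.Ring.Simple (fromCommutativeRing +-*-commutativeRing) _≟_

open ≡-Reasoning

ℕ→ℚ-mkℚ : ∀ m → ℕ→ℚ m ≡ mkℚ (ℤ.+ m) 0 (Coprime.sym (Coprime.1-coprimeTo m))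
ℕ→ℚ-mkℚ m = normalize-coprime (Coprime.sym (Coprime.1-coprimeTo m))

ℕ→ℚ-+ : ∀ m n → ℕ→ℚ (m ℕ.+ n) ≡ ℕ→ℚ m + ℕ→ℚ n
ℕ→ℚ-+ m n rewrite ℕ→ℚ-mkℚ m | ℕ→ℚ-mkℚ n | ℕ.*-identityʳ m | ℕ.*-identityʳ n =
  cong (_/ 1) (sym (cong₂ ℤ._+_ (+◃n≡+n m) (+◃n≡+n n)))

ℕ→ℚ-*-1/ : ∀ m .{{_ : NonZero m}} → ℕ→ℚ m * (ℤ.+ 1 / m) ≡ 1ℚ
ℕ→ℚ-*-1/ (suc m)
  rewrite ℕ→ℚ-mkℚ (suc m) | normalize-coprime {1} {m} (Coprime.1-coprimeTo (suc m)) =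
  *-inverseʳ (mkℚ (ℤ.+ suc m) 0 (Coprime.sym (Coprime.1-coprimeTo (suc m))))

a-zero : ∀ N → a N 0 ≡ 1ℚ
a-zero N = subst (λ k → ℕ→ℚ (N !) * inv! k ≡ 1ℚ) (sym (ℕ.+-identityʳ N))
                 (ℕ→ℚ-*-1/ (N !) {{N ℕ.!≢0}})

nCk≡0 : ∀ {n k} → n < k → n C k ≡ 0
nCk≡0 {n} {k} n<k with k ℕ.≤ᵇ n in eq
... | false = refl
... | true  = contradiction (ℕ.≤ᵇ⇒≤ k n (subst T (sym eq) tt)) (ℕ.<⇒≱ n<k)

∑ : ℕ → (ℕ → ℚ) → ℚ
∑ zero    u = 0ℚ
∑ (suc n) u = u 0 + ∑ n (λ i → u (suc i))

syntax ∑ n (λ i → u) = ∑[ i < n ] u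

∑-cong-< : ∀ n {u v : ℕ → ℚ} → (∀ i → i < n → u i ≡ v i) → ∑ n u ≡ ∑ n v
∑-cong-< zero    eq = refl
∑-cong-< (suc n) eq = cong₂ _+_ (eq 0 z<s) (∑-cong-< n (λ i i<n → eq (suc i) (s≤s i<n)))

∑-cong : ∀ n {u v : ℕ → ℚ} → (∀ i → u i ≡ v i) → ∑ n u ≡ ∑ n v
∑-cong n eq = ∑-cong-< n (λ i _ → eq i)

∑-0 : ∀ n → ∑[ i < n ] 0ℚ ≡ 0ℚ
∑-0 zero    = refl
∑-0 (suc n) = trans (cong (0ℚ +_) (∑-0 n)) (+-identityʳ 0ℚ)

∑-zero : ∀ n {u : ℕ → ℚ} → (∀ i → i < n → u i ≡ 0ℚ) → ∑ n u ≡ 0ℚ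
∑-zero n eq = trans (∑-cong-< n eq) (∑-0 n)

∑-distrib-+ : ∀ n (u v : ℕ → ℚ) → ∑[ i < n ] (u i + v i) ≡ ∑ n u + ∑ n v
∑-distrib-+ zero    u v = sym (+-identityʳ 0ℚ)
∑-distrib-+ (suc n) u v = begin
  (u 0 + v 0) + ∑[ i < n ] (u (suc i) + v (suc i))
    ≡⟨ cong ((u 0 + v 0) +_) (∑-distrib-+ n (λ i → u (suc i)) (λ i → v (suc i))) ⟩
  (u 0 + v 0) + (U + V)
    ≡⟨ solve 4 (λ x y X Y → (x :+ y) :+ (X :+ Y) := (x :+ X) :+ (y :+ Y)) refl (u 0) (v 0) U V ⟩
  (u 0 + U) + (v 0 + V) ∎
  where
  U = ∑[ i < n ] u (suc i)
  V = ∑[ i < n ] v (suc i)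

*-distribˡ-∑ : ∀ n c (u : ℕ → ℚ) → c * ∑ n u ≡ ∑[ i < n ] (c * u i)
*-distribˡ-∑ zero    c u = *-zeroʳ c
*-distribˡ-∑ (suc n) c u =
  trans (*-distribˡ-+ c (u 0) _) (cong (c * u 0 +_) (*-distribˡ-∑ n c (λ i → u (suc i))))

*-distribʳ-∑ : ∀ n c (u : ℕ → ℚ) → ∑ n u * c ≡ ∑[ i < n ] (u i * c)
*-distribʳ-∑ n c u =
  trans (*-comm (∑ n u) c) (trans (*-distribˡ-∑ n c u) (∑-cong n (λ i → *-comm c (u i))))

neg-distrib-∑ : ∀ n (u : ℕ → ℚ) → - ∑ n u ≡ ∑[ i < n ] (- u i)
neg-distrib-∑ zero    u = refl
neg-distrib-∑ (suc n) u =
  trans (neg-distrib-+ (u 0) _) (cong (- u 0 +_) (neg-distrib-∑ n (λ i → u (suc i))))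

∑-suc : ∀ n (u : ℕ → ℚ) → ∑ (suc n) u ≡ ∑ n u + u n
∑-suc zero    u = +-comm (u 0) 0ℚ
∑-suc (suc n) u =
  trans (cong (u 0 +_) (∑-suc n (λ i → u (suc i)))) (sym (+-assoc (u 0) _ (u (suc n))))

∑-comm : ∀ n m (w : ℕ → ℕ → ℚ) → ∑[ i < n ] ∑ m (w i) ≡ ∑[ j < m ] ∑[ i < n ] w i j
∑-comm zero    m w = sym (∑-0 m)
∑-comm (suc n) m w = trans (cong (∑ m (w 0) +_) (∑-comm n m (λ i → w (suc i))))
                           (sym (∑-distrib-+ m (w 0) (λ j → ∑[ i < n ] w (suc i) j)))

∑-extend : ∀ {n} m (u : ℕ → ℚ) → n ≤ m → (∀ i → n ≤ i → u i ≡ 0ℚ) → ∑ m u ≡ ∑ n u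
∑-extend {zero}  zero    u _  _ = refl
∑-extend {n}     (suc m) u n≤1+m u≡0 with ℕ.m≤n⇒m<n∨m≡n n≤1+m
... | inj₂ refl        = refl
... | inj₁ (s≤s n≤m) = begin
  ∑ (suc m) u   ≡⟨ ∑-suc m u ⟩
  ∑ m u + u m   ≡⟨ cong₂ _+_ (∑-extend m u n≤m u≡0) (u≡0 m n≤m) ⟩
  ∑ n u + 0ℚ    ≡⟨ +-identityʳ _ ⟩
  ∑ n u         ∎

Σℚ-++ : ∀ xs ys → Σℚ (xs ++ ys) ≡ Σℚ xs + Σℚ ys
Σℚ-++ []       ys = sym (+-identityˡ (Σℚ ys))
Σℚ-++ (x ∷ xs) ys = trans (cong (x +_) (Σℚ-++ xs ys)) (sym (+-assoc x (Σℚ xs) (Σℚ ys)))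

Σℚ-concatMap : ∀ {A B : Set} (φ : B → ℚ) (F : A → List B) xs →
  Σℚ (map φ (concatMap F xs)) ≡ Σℚ (map (λ x → Σℚ (map φ (F x))) xs)
Σℚ-concatMap φ F []       = refl
Σℚ-concatMap φ F (x ∷ xs) = begin
  Σℚ (map φ (F x ++ concatMap F xs))
    ≡⟨ cong Σℚ (map-++ φ (F x) (concatMap F xs)) ⟩
  Σℚ (map φ (F x) ++ map φ (concatMap F xs))
    ≡⟨ Σℚ-++ (map φ (F x)) _ ⟩
  Σℚ (map φ (F x)) + Σℚ (map φ (concatMap F xs))
    ≡⟨ cong (Σℚ (map φ (F x)) +_) (Σℚ-concatMap φ F xs) ⟩
  Σℚ (map φ (F x)) + Σℚ (map (λ x → Σℚ (map φ (F x))) xs) ∎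

Σℚ-map-applyUpTo : ∀ {A : Set} (φ : A → ℚ) (f : ℕ → A) n →
  Σℚ (map φ (applyUpTo f n)) ≡ ∑[ i < n ] φ (f i)
Σℚ-map-applyUpTo φ f zero    = refl
Σℚ-map-applyUpTo φ f (suc n) = cong (φ (f 0) +_) (Σℚ-map-applyUpTo φ (λ i → f (suc i)) n)

Σℚ-zipWith-applyDownFrom : ∀ (u t : ℕ → ℚ) n →
  Σℚ (zipWith _*_ (applyUpTo u (suc n)) (applyDownFrom t (suc n))) ≡ ∑[ j < suc n ] (u j * t (n ∸ j))
Σℚ-zipWith-applyDownFrom u t zero    = refl
Σℚ-zipWith-applyDownFrom u t (suc n) =
  cong (u 0 * t (suc n) +_) (Σℚ-zipWith-applyDownFrom (λ j → u (suc j)) t n)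

Series : Set
Series = ℕ → ℚ

δ : Series
δ zero    = 1ℚ
δ (suc _) = 0ℚ

_⊛_ : Series → Series → Series
(u ⊛ v) n = ∑[ j < suc n ] (u j * v (n ∸ j))

_^⊛_ : Series → ℕ → Series
u ^⊛ zero  = δ
u ^⊛ suc k = u ⊛ (u ^⊛ k)

δ-⊛ : ∀ v n → (δ ⊛ v) n ≡ v n
δ-⊛ v n = begin
  1ℚ * v n + ∑[ j < n ] (0ℚ * v (n ∸ suc j))
    ≡⟨ cong₂ _+_ (*-identityˡ (v n)) (∑-zero n (λ j _ → *-zeroˡ (v (n ∸ suc j)))) ⟩
  v n + 0ℚ ≡⟨ +-identityʳ (v n) ⟩
  v n      ∎

⊛-distribʳ-+ : ∀ (u v w : Series) n → ((λ j → u j + v j) ⊛ w) n ≡ (u ⊛ w) n + (v ⊛ w) n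
⊛-distribʳ-+ u v w n = trans (∑-cong (suc n) (λ j → *-distribʳ-+ (w (n ∸ j)) (u j) (v j)))
                             (∑-distrib-+ (suc n) (λ j → u j * w (n ∸ j)) (λ j → v j * w (n ∸ j)))

⊛-congʳ : ∀ u {v w : Series} n → (∀ p → v p ≡ w p) → (u ⊛ v) n ≡ (u ⊛ w) n
⊛-congʳ u n eq = ∑-cong (suc n) (λ j → cong (u j *_) (eq (n ∸ j)))

⊛-∑ʳ : ∀ m u (w : ℕ → Series) n → (u ⊛ (λ p → ∑[ k < m ] w k p)) n ≡ ∑[ k < m ] (u ⊛ w k) n
⊛-∑ʳ m u w n = trans (∑-cong (suc n) (λ j → *-distribˡ-∑ m (u j) (λ k → w k (n ∸ j))))
                     (∑-comm (suc n) m (λ j k → u j * w k (n ∸ j)))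

⊛-*ʳ : ∀ u c (w : Series) n → (u ⊛ (λ p → c * w p)) n ≡ c * (u ⊛ w) n
⊛-*ʳ u c w n = trans
  (∑-cong (suc n) (λ j → solve 3 (λ x y z → x :* (y :* z) := y :* (x :* z)) refl (u j) c (w (n ∸ j))))
  (sym (*-distribˡ-∑ (suc n) c (λ j → u j * w (n ∸ j))))

^⊛-scale : ∀ s (u : Series) k n → ((λ j → s * u j) ^⊛ k) n ≡ (s ^ℚ k) * (u ^⊛ k) n
^⊛-scale s u zero    n = sym (*-identityˡ (δ n))
^⊛-scale s u (suc k) n = begin
  ∑[ j < suc n ] ((s * u j) * ((λ j → s * u j) ^⊛ k) (n ∸ j))
    ≡⟨ ∑-cong (suc n) (λ j → cong ((s * u j) *_) (^⊛-scale s u k (n ∸ j))) ⟩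
  ∑[ j < suc n ] ((s * u j) * ((s ^ℚ k) * (u ^⊛ k) (n ∸ j)))
    ≡⟨ ∑-cong (suc n) (λ j → solve 4 (λ s x t y → (s :* x) :* (t :* y) := (s :* t) :* (x :* y))
                                        refl s (u j) (s ^ℚ k) ((u ^⊛ k) (n ∸ j))) ⟩
  ∑[ j < suc n ] ((s ^ℚ suc k) * (u j * (u ^⊛ k) (n ∸ j)))
    ≡⟨ sym (*-distribˡ-∑ (suc n) (s ^ℚ suc k) (λ j → u j * (u ^⊛ k) (n ∸ j))) ⟩
  (s ^ℚ suc k) * (u ^⊛ suc k) n ∎

Σℚ-weakComps : ∀ (w : Series) k n → Σℚ (map (λ is → Πℚ (map w is)) (weakComps k n)) ≡ (w ^⊛ k) n
Σℚ-weakComps w zero    zero    = +-identityʳ 1ℚ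
Σℚ-weakComps w zero    (suc n) = refl
Σℚ-weakComps w (suc k) n = begin
  Σℚ (map Πw (concatMap (λ i → map (i ∷_) (weakComps k (n ∸ i))) (upTo (suc n))))
    ≡⟨ Σℚ-concatMap Πw (λ i → map (i ∷_) (weakComps k (n ∸ i))) (upTo (suc n)) ⟩
  Σℚ (map (λ i → Σℚ (map Πw (map (i ∷_) (weakComps k (n ∸ i))))) (upTo (suc n)))
    ≡⟨ Σℚ-map-applyUpTo (λ i → Σℚ (map Πw (map (i ∷_) (weakComps k (n ∸ i))))) (λ i → i) (suc n) ⟩
  ∑[ i < suc n ] Σℚ (map Πw (map (i ∷_) (weakComps k (n ∸ i))))
    ≡⟨ ∑-cong (suc n) (λ i → Σℚ-cons i (weakComps k (n ∸ i))) ⟩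
  ∑[ i < suc n ] (w i * Σℚ (map Πw (weakComps k (n ∸ i))))
    ≡⟨ ∑-cong (suc n) (λ i → cong (w i *_) (Σℚ-weakComps w k (n ∸ i))) ⟩
  (w ^⊛ suc k) n ∎
  where
  Πw : List ℕ → ℚ
  Πw is = Πℚ (map w is)

  Σℚ-cons : ∀ i (iss : List (List ℕ)) → Σℚ (map Πw (map (i ∷_) iss)) ≡ w i * Σℚ (map Πw iss)
  Σℚ-cons i []         = sym (*-zeroʳ (w i))
  Σℚ-cons i (is ∷ iss) =
    trans (cong (w i * Πw is +_) (Σℚ-cons i iss)) (sym (*-distribˡ-+ (w i) (Πw is) _))

Cℚ : ℕ → ℕ → ℚ
Cℚ m k = ℕ→ℚ (m C k)

pascal : ∀ m k → Cℚ (suc m) (suc k) ≡ Cℚ m k + Cℚ m (suc k)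
pascal m k = trans (cong ℕ→ℚ (sym (nCk+nC[k+1]≡[n+1]C[k+1] m k))) (ℕ→ℚ-+ (m C k) (m C suc k))

∑-pascal : ∀ m (v : ℕ → ℚ) →
  ∑[ k < suc m ] (Cℚ m k * v k) + ∑[ k < suc m ] (Cℚ m k * v (suc k))
    ≡ ∑[ k < suc (suc m) ] (Cℚ (suc m) k * v k)
∑-pascal m v = begin
  (Cℚ m 0 * v 0 + L) + R              ≡⟨ +-assoc (Cℚ m 0 * v 0) L R ⟩
  Cℚ m 0 * v 0 + (L + R)              ≡⟨ cong (Cℚ m 0 * v 0 +_) (+-comm L R) ⟩
  Cℚ m 0 * v 0 + (R + L)              ≡⟨ cong (λ x → Cℚ m 0 * v 0 + (R + x)) (sym L-extend) ⟩
  Cℚ m 0 * v 0 + (R + ∑[ k < suc m ] (Cℚ m (suc k) * v (suc k)))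
    ≡⟨ cong (Cℚ m 0 * v 0 +_) (sym (∑-distrib-+ (suc m) (λ k → Cℚ m k * v (suc k)) (λ k → Cℚ m (suc k) * v (suc k)))) ⟩
  Cℚ m 0 * v 0 + ∑[ k < suc m ] (Cℚ m k * v (suc k) + Cℚ m (suc k) * v (suc k))
    ≡⟨ cong (Cℚ m 0 * v 0 +_) (∑-cong (suc m) (λ k →
         trans (sym (*-distribʳ-+ (v (suc k)) (Cℚ m k) (Cℚ m (suc k))))
               (cong (_* v (suc k)) (sym (pascal m k))))) ⟩
  Cℚ m 0 * v 0 + ∑[ k < suc m ] (Cℚ (suc m) (suc k) * v (suc k)) ∎
  where
  L = ∑[ k < m ] (Cℚ m (suc k) * v (suc k))
  R = ∑[ k < suc m ] (Cℚ m k * v (suc k))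
  L-extend : ∑[ k < suc m ] (Cℚ m (suc k) * v (suc k)) ≡ L
  L-extend = ∑-extend (suc m) _ (ℕ.n≤1+n m) λ k m≤k →
    trans (cong (λ c → ℕ→ℚ c * v (suc k)) (nCk≡0 (s≤s m≤k))) (*-zeroˡ (v (suc k)))

^⊛-binomial : ∀ (e : Series) m n → ((λ j → δ j + e j) ^⊛ m) n ≡ ∑[ k < suc m ] (Cℚ m k * (e ^⊛ k) n)
^⊛-binomial e zero    n = sym (trans (+-identityʳ (1ℚ * δ n)) (*-identityˡ (δ n)))
^⊛-binomial e (suc m) n = begin
  (g ⊛ (g ^⊛ m)) n
    ≡⟨ ⊛-distribʳ-+ δ e (g ^⊛ m) n ⟩
  (δ ⊛ (g ^⊛ m)) n + (e ⊛ (g ^⊛ m)) n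
    ≡⟨ cong₂ _+_ (trans (δ-⊛ (g ^⊛ m) n) (^⊛-binomial e m n)) (⊛-congʳ e n (^⊛-binomial e m)) ⟩
  ∑[ k < suc m ] (Cℚ m k * (e ^⊛ k) n) + (e ⊛ (λ p → ∑[ k < suc m ] (Cℚ m k * (e ^⊛ k) p))) n
    ≡⟨ cong (∑[ k < suc m ] (Cℚ m k * (e ^⊛ k) n) +_) (trans
         (⊛-∑ʳ (suc m) e (λ k p → Cℚ m k * (e ^⊛ k) p) n)
         (∑-cong (suc m) (λ k → ⊛-*ʳ e (Cℚ m k) (e ^⊛ k) n))) ⟩
  ∑[ k < suc m ] (Cℚ m k * (e ^⊛ k) n) + ∑[ k < suc m ] (Cℚ m k * (e ^⊛ suc k) n)
    ≡⟨ ∑-pascal m (λ k → (e ^⊛ k) n) ⟩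
  ∑[ k < suc (suc m) ] (Cℚ (suc m) k * (e ^⊛ k) n) ∎
  where
  g = λ j → δ j + e j

hockey-stick : ∀ n k → ∑[ m < suc n ] Cℚ m k ≡ Cℚ (suc n) (suc k)
hockey-stick zero    k = begin
  Cℚ 0 k + 0ℚ           ≡⟨ cong (λ c → Cℚ 0 k + ℕ→ℚ c) (sym (nCk≡0 (z<s {k}))) ⟩
  Cℚ 0 k + Cℚ 0 (suc k) ≡⟨ sym (pascal 0 k) ⟩
  Cℚ 1 (suc k)          ∎
hockey-stick (suc n) k = begin
  ∑[ m < suc (suc n) ] Cℚ m k              ≡⟨ ∑-suc (suc n) (λ m → Cℚ m k) ⟩
  ∑[ m < suc n ] Cℚ m k + Cℚ (suc n) k     ≡⟨ cong (_+ Cℚ (suc n) k) (hockey-stick n k) ⟩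
  Cℚ (suc n) (suc k) + Cℚ (suc n) k        ≡⟨ +-comm (Cℚ (suc n) (suc k)) (Cℚ (suc n) k) ⟩
  Cℚ (suc n) k + Cℚ (suc n) (suc k)        ≡⟨ sym (pascal (suc n) k) ⟩
  Cℚ (suc (suc n)) (suc k)                 ∎

-- The series Σ_m g^m = 1/(1 - g) when g(0) = 0; only m ≤ n contribute to the x^n coefficient.
geometric : Series → Series
geometric g n = ∑[ m < suc n ] (g ^⊛ m) n

module _ {g : Series} (g0≡0 : g 0 ≡ 0ℚ) where

  ^⊛-vanishes : ∀ m n → n < m → (g ^⊛ m) n ≡ 0ℚ
  ^⊛-vanishes (suc m) n (s≤s n≤m) = ∑-zero (suc n) term≡0
    where
    term≡0 : ∀ j → j < suc n → g j * (g ^⊛ m) (n ∸ j) ≡ 0ℚ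
    term≡0 zero    _           = trans (cong (_* (g ^⊛ m) n) g0≡0) (*-zeroˡ ((g ^⊛ m) n))
    term≡0 (suc j) (s≤s 1+j≤n) =
      trans (cong (g (suc j) *_) (^⊛-vanishes m (n ∸ suc j) (ℕ.<-≤-trans (ℕ.∸-monoʳ-< z<s 1+j≤n) n≤m)))
            (*-zeroʳ (g (suc j)))

  geometric-extend : ∀ n p → p ≤ n → geometric g p ≡ ∑[ m < suc n ] (g ^⊛ m) p
  geometric-extend n p p≤n = sym (∑-extend (suc n) _ (s≤s p≤n) (λ m p<m → ^⊛-vanishes m p p<m))

  geometric-fixpoint : ∀ n → geometric g n ≡ δ n + (g ⊛ geometric g) n
  geometric-fixpoint n = cong (δ n +_) (sym (begin
    (g ⊛ geometric g) n
      ≡⟨ ∑-cong (suc n) (λ j → cong (g j *_) (geometric-extend n (n ∸ j) (ℕ.m∸n≤m n j))) ⟩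
    (g ⊛ (λ p → ∑[ m < suc n ] (g ^⊛ m) p)) n
      ≡⟨ ⊛-∑ʳ (suc n) g (g ^⊛_) n ⟩
    ∑[ m < suc n ] (g ^⊛ suc m) n
      ≡⟨ ∑-suc n _ ⟩
    ∑[ m < n ] (g ^⊛ suc m) n + (g ^⊛ suc n) n
      ≡⟨ cong (∑[ m < n ] (g ^⊛ suc m) n +_) (^⊛-vanishes (suc n) n (ℕ.n<1+n n)) ⟩
    ∑[ m < n ] (g ^⊛ suc m) n + 0ℚ
      ≡⟨ +-identityʳ _ ⟩
    ∑[ m < n ] (g ^⊛ suc m) n ∎))

  geometric-suc : ∀ n → geometric g (suc n) ≡ ∑[ j < suc n ] (g (suc j) * geometric g (n ∸ j))
  geometric-suc n = begin
    geometric g (suc n)                          ≡⟨ geometric-fixpoint (suc n) ⟩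
    0ℚ + (g 0 * geometric g (suc n) + Rest)      ≡⟨ +-identityˡ _ ⟩
    g 0 * geometric g (suc n) + Rest             ≡⟨ cong (λ x → x * geometric g (suc n) + Rest) g0≡0 ⟩
    0ℚ * geometric g (suc n) + Rest              ≡⟨ cong (_+ Rest) (*-zeroˡ (geometric g (suc n))) ⟩
    0ℚ + Rest                                    ≡⟨ +-identityˡ Rest ⟩
    Rest                                         ∎
    where
    Rest = ∑[ j < suc n ] (g (suc j) * geometric g (n ∸ j))

geometric-binomial : ∀ (e : Series) n →
  geometric (λ j → δ j + e j) n ≡ ∑[ k < suc n ] (Cℚ (suc n) (suc k) * (e ^⊛ k) n)
geometric-binomial e n = begin
  ∑[ m < suc n ] ((λ j → δ j + e j) ^⊛ m) n
    ≡⟨ ∑-cong-< (suc n) (λ m m<1+n → trans (^⊛-binomial e m n)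
         (sym (∑-extend (suc n) _ m<1+n λ k m<k →
           trans (cong (λ c → ℕ→ℚ c * (e ^⊛ k) n) (nCk≡0 m<k)) (*-zeroˡ ((e ^⊛ k) n))))) ⟩
  ∑[ m < suc n ] ∑[ k < suc n ] (Cℚ m k * (e ^⊛ k) n)
    ≡⟨ ∑-comm (suc n) (suc n) (λ m k → Cℚ m k * (e ^⊛ k) n) ⟩
  ∑[ k < suc n ] ∑[ m < suc n ] (Cℚ m k * (e ^⊛ k) n)
    ≡⟨ ∑-cong (suc n) (λ k → trans (sym (*-distribʳ-∑ (suc n) ((e ^⊛ k) n) (λ m → Cℚ m k)))
                                   (cong (_* (e ^⊛ k) n) (hockey-stick n k))) ⟩
  ∑[ k < suc n ] (Cℚ (suc n) (suc k) * (e ^⊛ k) n) ∎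

invCoeff-unique : ∀ N (t : Series) → t 0 ≡ 1ℚ →
  (∀ n → t (suc n) ≡ - ∑[ j < suc n ] (a N (suc j) * t (n ∸ j))) →
  ∀ n → invCoeff N n ≡ t n
invCoeff-unique N t t0≡1 t-suc = invCoeff≡
  where
  head≡ : ∀ n → - Σℚ (zipWith _*_ (applyUpTo (λ j → a N (suc j)) (suc n)) (applyDownFrom t (suc n)))
                  ≡ t (suc n)
  head≡ n = trans (cong -_ (Σℚ-zipWith-applyDownFrom (λ j → a N (suc j)) t n)) (sym (t-suc n))

  invList≡ : ∀ n → invList N n ≡ applyDownFrom t (suc n)
  invList≡ zero                        = cong (_∷ []) (sym t0≡1)
  invList≡ (suc n) rewrite invList≡ n = cong (_∷ applyDownFrom t (suc n)) (head≡ n)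

  invCoeff≡ : ∀ n → invCoeff N n ≡ t n
  invCoeff≡ zero                        = sym t0≡1
  invCoeff≡ (suc n) rewrite invList≡ n = head≡ n

module _ (N : ℕ) where

  -- e = -a, written as a scalar multiple so that ^⊛-scale applies to it.
  e : Series
  e j = (- ℕ→ℚ (N !)) * inv! (N ℕ.+ j)

  e≡-a : ∀ j → e j ≡ - a N j
  e≡-a j = sym (neg-distribˡ-* (ℕ→ℚ (N !)) (inv! (N ℕ.+ j)))

  g : Series
  g j = δ j + e j

  g0≡0 : g 0 ≡ 0ℚ
  g0≡0 = trans (cong (λ x → 1ℚ + x) (trans (e≡-a 0) (cong -_ (a-zero N)))) (+-inverseʳ 1ℚ)

  invCoeff≡geometric : ∀ n → invCoeff N n ≡ geometric g n
  invCoeff≡geometric = invCoeff-unique N (geometric g) (+-identityʳ 1ℚ) λ n → begin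
    geometric g (suc n)
      ≡⟨ geometric-suc {g} g0≡0 n ⟩
    ∑[ j < suc n ] ((0ℚ + e (suc j)) * geometric g (n ∸ j))
      ≡⟨ ∑-cong (suc n) (λ j → trans (cong (_* geometric g (n ∸ j)) (trans (+-identityˡ _) (e≡-a (suc j))))
                                     (sym (neg-distribˡ-* (a N (suc j)) (geometric g (n ∸ j))))) ⟩
    ∑[ j < suc n ] (- (a N (suc j) * geometric g (n ∸ j)))
      ≡⟨ sym (neg-distrib-∑ (suc n) (λ j → a N (suc j) * geometric g (n ∸ j))) ⟩
    - ∑[ j < suc n ] (a N (suc j) * geometric g (n ∸ j)) ∎

  e^⊛≡innerSum : ∀ k n → (e ^⊛ k) n ≡ ((- ℕ→ℚ (N !)) ^ℚ k) * innerSum N k n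
  e^⊛≡innerSum k n = trans (^⊛-scale (- ℕ→ℚ (N !)) (λ i → inv! (N ℕ.+ i)) k n)
                           (cong (((- ℕ→ℚ (N !)) ^ℚ k) *_) (sym (Σℚ-weakComps (λ i → inv! (N ℕ.+ i)) k n)))

proposition2 : (N : ℕ) → 1 ≤ N → (n : ℕ) → 1 ≤ n → B N n ≡ rhs N n
proposition2 N _ (suc n) _ = cong (ℕ→ℚ (suc n !) *_) (begin
  invCoeff N (suc n)
    ≡⟨ invCoeff≡geometric N (suc n) ⟩
  geometric (g N) (suc n)
    ≡⟨ geometric-binomial (e N) (suc n) ⟩
  Cℚ (2 ℕ.+ n) 1 * 0ℚ + ∑[ k < suc n ] (Cℚ (2 ℕ.+ n) (2 ℕ.+ k) * (e N ^⊛ suc k) (suc n))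
    ≡⟨ cong₂ _+_ (*-zeroʳ (Cℚ (2 ℕ.+ n) 1)) (∑-cong (suc n) λ k →
         trans (cong (Cℚ (2 ℕ.+ n) (2 ℕ.+ k) *_) (e^⊛≡innerSum N (suc k) (suc n)))
               (solve 3 (λ x y z → x :* (y :* z) := y :* x :* z) refl
                      (Cℚ (2 ℕ.+ n) (2 ℕ.+ k)) ((- ℕ→ℚ (N !)) ^ℚ suc k) (innerSum N (suc k) (suc n)))) ⟩
  0ℚ + ∑[ k < suc n ] (φ (suc k))
    ≡⟨ +-identityˡ _ ⟩
  ∑[ k < suc n ] (φ (suc k))
    ≡⟨ sym (Σℚ-map-applyUpTo φ suc (suc n)) ⟩
  Σℚ (map φ (applyUpTo suc (suc n))) ∎)
  where
  φ : ℕ → ℚ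
  φ k = ((- ℕ→ℚ (N !)) ^ℚ k) * ℕ→ℚ (suc (suc n) C suc k) * innerSum N k (suc n)
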